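{- Let $q=p^m$ with $p$ prime, let $T:\mathbb{F}_q^3\rightarrow\mathbb{F}_q$ and $\theta:\mathbb{F}_q^3\rightarrow\mathrm{Aut}(\mathbb{F}_q)$ be two functions, write $\theta_{a,b,c}:=\theta(a,b,c)$, and set $\mathfrak{g}_{a,b,c}:=(E(a,b,c,T(a,b,c)),\,\theta_{a,b,c})$ and $G:=\{\mathfrak{g}_{a,b,c}:\,a,b,c\in\mathbb{F}_q\}$. Then $G$ is a group acting regularly on the points of the Payne derived quadrangle $\mathcal{Q}^P$ if and only if for all triples $(a,b,c)$ and $(x,y,z)$ in $\mathbb{F}_q^3$ we have $\mathfrak{g}_{a,b,c}\circ\mathfrak{g}_{x,y,z}=\mathfrak{g}_{u,v,w}$, which is equivalent to $$\theta_{a,b,c}\theta_{x,y,z}=\theta_{u,v,w},\qquad T(a,b,c)^{\theta_{x,y,z}}+T(x,y,z)=T(u,v,w),$$ where $w=c^{\theta_{x,y,z}}+z$, $v=b^{\theta_{x,y,z}}+y+c^{\theta_{x,y,z}}T(x,y,z)$ and $u=a^{\theta_{x,y,z}}+x-b^{\theta_{x,y,z}}z+c^{\theta_{x,y,z}}y-c^{\theta_{x,y,z}}zT(x,y,z)$.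
   Context: Let $V=\mathbb{F}_q^4$ carry the alternating form $(x,y)=x_1y_4-x_4y_1+x_2y_3-x_3y_2$, and let $W(q)$ be the symplectic generalized quadrangle whose points are all points of $\mathrm{PG}(3,q)$ and whose lines are the totally isotropic lines. Let $P=\langle(1,0,0,0)\rangle$. The Payne derived quadrangle $\mathcal{Q}^P$ has as points the projective points not in $P^\perp$, namely $\langle(a,b,c,1)\rangle$, $a,b,c\in\mathbb{F}_q$, and as lines the totally isotropic lines not containing $P$ together with the lines $\langle P,Q\rangle$ with $Q\notin P^\perp$. For $a,b,c,t\in\mathbb{F}_q$ let $E(a,b,c,t)$ be the $4\times4$ matrix over $\mathbb{F}_q$ with rows $(1,0,0,0)$, $(-c,1,0,0)$, $(b-ct,t,1,0)$, $(a,b,c,1)$. A pair $(A,\sigma)$ with $A\in\mathrm{GL}(4,q)$, $\sigma\in\mathrm{Aut}(\mathbb{F}_q)$ denotes the semilinear map $x\mapsto x^{\sigma}A$ on row vectors (with $x^\sigma$ obtained by applying $\sigma$ to each coordinate), acting on projective points; each $\mathfrak{g}_{a,b,c}$ lies in the stabilizer of $P$ in $\mathrm{P\Gamma Sp}(4,q)$ and so acts on $\mathcal{Q}^P$. Composition is $(A_1,\sigma_1)\circ(A_2,\sigma_2)=(A_1^{\sigma_2}A_2,\sigma_1\sigma_2)$, where $A^{\sigma}$ applies $\sigma$ to each entry of $A$. The element $\mathfrak{g}_{a,b,c}$ maps $\langle(0,0,0,1)\rangle$ to $\langle(a,b,c,1)\rangle$. -}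

module Defs where

open import Data.Nat using (ℕ) renaming (_^_ to _^ℕ_)
open import Data.Nat.Primality using (Prime)
open import Data.Fin using (Fin; zero; suc)
open import Data.Product using (Σ; ∃; _×_; _,_)
open import Relation.Binary.PropositionalEquality using (_≡_)
open import Relation.Nullary using (¬_; yes; no)
import Data.Fin
open import Function.Bundles using (_↔_)
open import Function.Definitions using (Bijective)
open import Algebra.Structures using (IsCommutativeRing)

record FiniteField : Set₁ where
  infixl 6 _+_
  infixl 7 _*_
  infix 8 -_
  field
    F : Set
    _+_ _*_ : F → F → F
    -_ : F → F
    0# 1# : F
    isCommutativeRing : IsCommutativeRing _≡_ _+_ _*_ -_ 0# 1#
    0≢1 : ¬ (0# ≡ 1#)
    inverse : ∀ x → ¬ (x ≡ 0#) → ∃ λ y → x * y ≡ 1#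
    p m : ℕ
    p-prime : Prime p
    card : Fin (p ^ℕ m) ↔ F

module FF (K : FiniteField) where
  open FiniteField K public

  infixl 6 _-_
  _-_ : F → F → F
  a - b = a + (- b)

  record Aut : Set where
    field
      ⟦_⟧ : F → F
      hom-+ : ∀ x y → ⟦ x + y ⟧ ≡ ⟦ x ⟧ + ⟦ y ⟧
      hom-* : ∀ x y → ⟦ x * y ⟧ ≡ ⟦ x ⟧ * ⟦ y ⟧
      hom-1 : ⟦ 1# ⟧ ≡ 1#
      bij : Bijective _≡_ _≡_ ⟦_⟧
  open Aut public

  Vec4 : Set
  Vec4 = Fin 4 → F

  Mat4 : Set
  Mat4 = Fin 4 → Fin 4 → F

  sum4 : (Fin 4 → F) → F
  sum4 f = f zero + (f (suc zero) + (f (suc (suc zero)) + f (suc (suc (suc zero)))))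

  _·ᵥ_ : Vec4 → Mat4 → Vec4
  (x ·ᵥ A) j = sum4 λ i → x i * A i j

  _·ₘ_ : Mat4 → Mat4 → Mat4
  (A ·ₘ B) i j = sum4 λ k → A i k * B k j

  idMat : Mat4
  idMat i j with i Data.Fin.≟ j
  ... | yes _ = 1#
  ... | no _ = 0#

  -- A semilinear map (A , σ) : x ↦ x^σ A (σ a field automorphism, given by its underlying map)
  record SemiLin : Set where
    constructor ⟨_,_⟩
    field
      mat : Mat4
      fun : F → F
  open SemiLin public

  apply : SemiLin → Vec4 → Vec4
  apply g x = (λ i → fun g (x i)) ·ᵥ mat g

  -- (A₁,σ₁) ∘ (A₂,σ₂) = (A₁^σ₂ A₂ , σ₁σ₂), where x^(σ₁σ₂) = (x^σ₁)^σ₂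
  _∘ₛ_ : SemiLin → SemiLin → SemiLin
  ⟨ A₁ , σ₁ ⟩ ∘ₛ ⟨ A₂ , σ₂ ⟩ = ⟨ (λ i j → σ₂ (A₁ i j)) ·ₘ A₂ , (λ t → σ₂ (σ₁ t)) ⟩

  idSL : SemiLin
  idSL = ⟨ idMat , (λ t → t) ⟩

  -- equality in PΓL(4,q): same automorphism, matrices equal up to a nonzero scalar
  _≈_ : SemiLin → SemiLin → Set
  g ≈ h = (∀ t → fun g t ≡ fun h t)
        × (Σ F λ λ' → ¬ (λ' ≡ 0#) × (∀ i j → mat h i j ≡ λ' * mat g i j))

  _∼_ : Vec4 → Vec4 → Set
  x ∼ y = Σ F λ λ' → ¬ (λ' ≡ 0#) × (∀ i → y i ≡ λ' * x i)

  form : Vec4 → Vec4 → F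
  form x y = x zero * y (suc (suc (suc zero))) - x (suc (suc (suc zero))) * y zero
           + (x (suc zero) * y (suc (suc zero)) - x (suc (suc zero)) * y (suc zero))

  Pvec : Vec4
  Pvec zero = 1#
  Pvec (suc _) = 0#

  -- points of the Payne derived quadrangle Q^P: projective points not in P^⊥
  record QPoint : Set where
    field
      vec : Vec4
      notPerp : ¬ (form Pvec vec ≡ 0#)
  open QPoint public

  E : F → F → F → F → Mat4
  E a b c t zero zero = 1#
  E a b c t zero (suc _) = 0#
  E a b c t (suc zero) zero = - c
  E a b c t (suc zero) (suc zero) = 1#
  E a b c t (suc zero) (suc (suc _)) = 0#
  E a b c t (suc (suc zero)) zero = b - c * t
  E a b c t (suc (suc zero)) (suc zero) = t
  E a b c t (suc (suc zero)) (suc (suc zero)) = 1#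
  E a b c t (suc (suc zero)) (suc (suc (suc zero))) = 0#
  E a b c t (suc (suc (suc zero))) zero = a
  E a b c t (suc (suc (suc zero))) (suc zero) = b
  E a b c t (suc (suc (suc zero))) (suc (suc zero)) = c
  E a b c t (suc (suc (suc zero))) (suc (suc (suc zero))) = 1#

  module _ (T : F → F → F → F) (θ : F → F → F → Aut) where

    𝔤 : F → F → F → SemiLin
    𝔤 a b c = ⟨ E a b c (T a b c) , ⟦ θ a b c ⟧ ⟩

    GIsGroup : Set
    GIsGroup =
        (Σ F λ a → Σ F λ b → Σ F λ c → 𝔤 a b c ≈ idSL)
      × (∀ a b c x y z → Σ F λ u → Σ F λ v → Σ F λ w → (𝔤 a b c ∘ₛ 𝔤 x y z) ≈ 𝔤 u v w)
      × (∀ a b c → Σ F λ x → Σ F λ y → Σ F λ z → (𝔤 a b c ∘ₛ 𝔤 x y z) ≈ idSL)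

    GActsRegularly : Set
    GActsRegularly = ∀ (X Y : QPoint) →
        (Σ F λ a → Σ F λ b → Σ F λ c → apply (𝔤 a b c) (vec X) ∼ vec Y)
      × (∀ a b c a' b' c' → apply (𝔤 a b c) (vec X) ∼ vec Y
                          → apply (𝔤 a' b' c') (vec X) ∼ vec Y
                          → 𝔤 a b c ≈ 𝔤 a' b' c')

    module _ (a b c x y z : F) where
      private
        σ : F → F
        σ = ⟦ θ x y z ⟧
        t : F
        t = T x y z
      wᶜ vᶜ uᶜ : F
      wᶜ = σ c + z
      vᶜ = σ b + y + σ c * t
      uᶜ = σ a + x - σ b * z + σ c * y - σ c * z * t

    CompositionLaw : Set
    CompositionLaw = ∀ a b c x y z →
      (𝔤 a b c ∘ₛ 𝔤 x y z) ≈ 𝔤 (uᶜ a b c x y z) (vᶜ a b c x y z) (wᶜ a b c x y z)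

    FunctionalEqs : Set
    FunctionalEqs = ∀ a b c x y z →
      let u = uᶜ a b c x y z ; v = vᶜ a b c x y z ; w = wᶜ a b c x y z in
        (∀ s → ⟦ θ x y z ⟧ (⟦ θ a b c ⟧ s) ≡ ⟦ θ u v w ⟧ s)
      × (⟦ θ x y z ⟧ (T a b c) + T x y z ≡ T u v w)

module Submission where

-- The matrices E(a,b,c,t) form a group, E(v) E(w) = E(v ⋆ w), on which field
-- automorphisms act entrywise as ⋆-automorphisms.  The matrix of 𝔤_p is E(p, T p),
-- so 𝔤_p ∘ 𝔤_q has matrix E((p, T p)^θ_q ⋆ (q, T q)); as the (1,1) entry of every
-- E is 1, the scalar in 𝔤_p ∘ 𝔤_q ≈ 𝔤_r must be 1, and comparing entries shows that
-- this happens exactly when θ_q θ_p = θ_r and (r, T r) = (p, T p)^θ_q ⋆ (q, T q).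
-- Hence closure of G already forces r = (u,v,w), and the composition law is
-- equivalent to the functional equations.  Under these equations the law
-- p ⊙ q = (u,v,w) inherits associativity from ⋆, has the neutral element 0 and
-- left inverses, so it is a group; since 𝔤_q maps ⟨(p,1)⟩ to ⟨(p ⊙ q,1)⟩ and
-- every point of the quadrangle has this form, regularity amounts to unique
-- solvability of p ⊙ q = p′.

open import Algebra.Bundles using (CommutativeRing)
open import Algebra.Definitions using (Associative; LeftIdentity; RightIdentity)
open import Algebra.Solver.Ring.AlmostCommutativeRing using (fromCommutativeRing; _-Raw-AlmostCommutative⟶_)
open import Data.Fin using (Fin; suc)
open import Data.Fin.Patterns using (0F; 1F; 2F; 3F)
import Data.Integer as ℤ
import Data.Integer.Properties as ℤ
import Data.Maybe as Maybe
open import Data.Nat as ℕ using (ℕ; zero; suc)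
import Data.Nat.Properties as ℕ
open import Data.Product using (Σ; _×_; _,_; proj₁; proj₂)
open import Data.Sign as Sign using (Sign)
open import Data.Vec.N-ary using (N-ary)
open import Function.Base using (_∘_)
open import Function.Bundles using (_⇔_; mk⇔)
open import Relation.Binary.PropositionalEquality as ≡ using (_≡_)
open import Relation.Nullary using (¬_)
open import Relation.Nullary.Decidable using (dec⇒maybe)

open import Defs

-- Integer coefficients for Algebra.Solver.Ring over any commutative ring: with natural
-- coefficients (Algebra.Solver.Ring.NaturalCoefficients) subtraction is not expressible.
module IntegerCoefficients {c ℓ} (R : CommutativeRing c ℓ) where
  open CommutativeRing R
  open import Data.Integer using (ℤ; +_; -[1+_]; +[1+_]; sign; ∣_∣; _◃_; _⊖_)
  open import Algebra.Properties.Ring ring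
    using (-‿involutive; -‿anti-homo-+; -0#≈0#; -‿distribˡ-*; -‿distribʳ-*)
  open import Algebra.Properties.AbelianGroup +-abelianGroup using (xyx⁻¹≈y)
  open import Algebra.Properties.Semiring.Mult.TCOptimised semiring
    using (×-homo-+; ×1-homo-*) renaming (_×_ to _×ₙ_)
  open import Relation.Binary.Reasoning.Setoid setoid

  signed : Sign → Carrier → Carrier
  signed Sign.+ x = x
  signed Sign.- x = - x

  signed-cong : ∀ s {x y} → x ≈ y → signed s x ≈ signed s y
  signed-cong Sign.+ x≈y = x≈y
  signed-cong Sign.- x≈y = -‿cong x≈y

  signed-* : ∀ s t x y → signed (s Sign.* t) (x * y) ≈ signed s x * signed t y
  signed-* Sign.+ Sign.+ x y = refl
  signed-* Sign.+ Sign.- x y = -‿distribʳ-* x y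
  signed-* Sign.- Sign.+ x y = -‿distribˡ-* x y
  signed-* Sign.- Sign.- x y = begin
    x * y        ≈⟨ -‿involutive (x * y) ⟨
    - - (x * y)  ≈⟨ -‿cong (-‿distribˡ-* x y) ⟩
    - (- x * y)  ≈⟨ -‿distribʳ-* (- x) y ⟩
    - x * - y    ∎

  -‿cancel-+ˡ : ∀ x y z → (x + y) - (x + z) ≈ y - z
  -‿cancel-+ˡ x y z = begin
    (x + y) + - (x + z)    ≈⟨ +-congˡ (-‿anti-homo-+ x z) ⟩
    (x + y) + (- z + - x)  ≈⟨ +-assoc (x + y) (- z) (- x) ⟨
    (x + y) + - z + - x    ≈⟨ +-congʳ (+-assoc x y (- z)) ⟩
    x + (y - z) + - x      ≈⟨ xyx⁻¹≈y x (y - z) ⟩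
    y - z                  ∎

  ⟦_⟧ℤ : ℤ → Carrier
  ⟦ i ⟧ℤ = signed (sign i) (∣ i ∣ ×ₙ 1#)

  ⟦◃⟧ : ∀ s n → ⟦ s ◃ n ⟧ℤ ≈ signed s (n ×ₙ 1#)
  ⟦◃⟧ Sign.+ zero    = refl
  ⟦◃⟧ Sign.- zero    = sym -0#≈0#
  ⟦◃⟧ Sign.+ (suc n) = refl
  ⟦◃⟧ Sign.- (suc n) = refl

  ⟦⊖⟧ : ∀ m n → ⟦ m ⊖ n ⟧ℤ ≈ m ×ₙ 1# - n ×ₙ 1#
  ⟦⊖⟧ zero    zero    = sym (-‿inverseʳ 0#)
  ⟦⊖⟧ zero    (suc n) = sym (+-identityˡ _)
  ⟦⊖⟧ (suc m) zero    = begin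
    suc m ×ₙ 1#       ≈⟨ +-identityʳ _ ⟨
    suc m ×ₙ 1# + 0#  ≈⟨ +-congˡ -0#≈0# ⟨
    suc m ×ₙ 1# - 0#  ∎
  ⟦⊖⟧ (suc m) (suc n) = begin
    ⟦ suc m ⊖ suc n ⟧ℤ             ≡⟨ ≡.cong ⟦_⟧ℤ (ℤ.[1+m]⊖[1+n]≡m⊖n m n) ⟩
    ⟦ m ⊖ n ⟧ℤ                     ≈⟨ ⟦⊖⟧ m n ⟩
    m ×ₙ 1# - n ×ₙ 1#                ≈⟨ -‿cancel-+ˡ 1# (m ×ₙ 1#) (n ×ₙ 1#) ⟨
    (1# + m ×ₙ 1#) - (1# + n ×ₙ 1#)  ≈⟨ +-cong (×-homo-+ 1# 1 m) (-‿cong (×-homo-+ 1# 1 n)) ⟨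
    suc m ×ₙ 1# - suc n ×ₙ 1#        ∎

  ⟦⟧ℤ-+ : ∀ i j → ⟦ i ℤ.+ j ⟧ℤ ≈ ⟦ i ⟧ℤ + ⟦ j ⟧ℤ
  ⟦⟧ℤ-+ (+ m)     (+ n)     = ×-homo-+ 1# m n
  ⟦⟧ℤ-+ (+ m)     -[1+ n ]  = ⟦⊖⟧ m (suc n)
  ⟦⟧ℤ-+ -[1+ m ]  (+ n)     = trans (⟦⊖⟧ n (suc m)) (+-comm _ _)
  ⟦⟧ℤ-+ -[1+ m ]  -[1+ n ]  = begin
    - (suc (suc m ℕ.+ n) ×ₙ 1#)       ≡⟨ ≡.cong (λ k → - (k ×ₙ 1#)) (ℕ.+-suc (suc m) n) ⟨
    - ((suc m ℕ.+ suc n) ×ₙ 1#)       ≈⟨ -‿cong (×-homo-+ 1# (suc m) (suc n)) ⟩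
    - (suc m ×ₙ 1# + suc n ×ₙ 1#)      ≈⟨ -‿anti-homo-+ _ _ ⟩
    - (suc n ×ₙ 1#) + - (suc m ×ₙ 1#)  ≈⟨ +-comm _ _ ⟩
    - (suc m ×ₙ 1#) + - (suc n ×ₙ 1#)  ∎

  ⟦⟧ℤ-* : ∀ i j → ⟦ i ℤ.* j ⟧ℤ ≈ ⟦ i ⟧ℤ * ⟦ j ⟧ℤ
  ⟦⟧ℤ-* i j = begin
    ⟦ s ◃ ∣ i ∣ ℕ.* ∣ j ∣ ⟧ℤ                ≈⟨ ⟦◃⟧ s (∣ i ∣ ℕ.* ∣ j ∣) ⟩
    signed s ((∣ i ∣ ℕ.* ∣ j ∣) ×ₙ 1#)       ≈⟨ signed-cong s (×1-homo-* ∣ i ∣ ∣ j ∣) ⟩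
    signed s ((∣ i ∣ ×ₙ 1#) * (∣ j ∣ ×ₙ 1#))  ≈⟨ signed-* (sign i) (sign j) _ _ ⟩
    ⟦ i ⟧ℤ * ⟦ j ⟧ℤ                         ∎
    where s = sign i Sign.* sign j

  ⟦⟧ℤ-- : ∀ i → ⟦ ℤ.- i ⟧ℤ ≈ - ⟦ i ⟧ℤ
  ⟦⟧ℤ-- (+ zero)  = sym -0#≈0#
  ⟦⟧ℤ-- +[1+ n ]  = refl
  ⟦⟧ℤ-- -[1+ n ]  = sym (-‿involutive _)

  homomorphism : ℤ.+-*-rawRing -Raw-AlmostCommutative⟶ fromCommutativeRing R
  homomorphism = record
    { ⟦_⟧    = ⟦_⟧ℤ
    ; +-homo = ⟦⟧ℤ-+
    ; *-homo = ⟦⟧ℤ-*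
    ; -‿homo = ⟦⟧ℤ--
    ; 0-homo = refl
    ; 1-homo = refl
    }

  open import Algebra.Solver.Ring ℤ.+-*-rawRing (fromCommutativeRing R) homomorphism
    (λ i j → Maybe.map (reflexive ∘ ≡.cong ⟦_⟧ℤ) (dec⇒maybe (i ℤ.≟ j)))
    public

module LeftInverses {a} {A : Set a} (_∙_ : A → A → A) (ε : A)
  (assoc : Associative _≡_ _∙_)
  (identityˡ : LeftIdentity _≡_ ε _∙_) (identityʳ : RightIdentity _≡_ ε _∙_)
  (inverseˡ : ∀ x → Σ A λ y → y ∙ x ≡ ε)
  where
  open ≡.≡-Reasoning

  cancelˡ : ∀ x {y z} → x ∙ y ≡ x ∙ z → y ≡ z
  cancelˡ x {y} {z} xy≡xz = begin
    y              ≡⟨ identityˡ y ⟨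
    ε ∙ y          ≡⟨ ≡.cong (_∙ y) x⁻¹x≡ε ⟨
    (x⁻¹ ∙ x) ∙ y  ≡⟨ assoc x⁻¹ x y ⟩
    x⁻¹ ∙ (x ∙ y)  ≡⟨ ≡.cong (x⁻¹ ∙_) xy≡xz ⟩
    x⁻¹ ∙ (x ∙ z)  ≡⟨ assoc x⁻¹ x z ⟨
    (x⁻¹ ∙ x) ∙ z  ≡⟨ ≡.cong (_∙ z) x⁻¹x≡ε ⟩
    ε ∙ z          ≡⟨ identityˡ z ⟩
    z              ∎
    where
    x⁻¹ = proj₁ (inverseˡ x)
    x⁻¹x≡ε = proj₂ (inverseˡ x)

  inverseʳ : ∀ x → Σ A λ y → x ∙ y ≡ ε
  inverseʳ x = x⁻¹ , cancelˡ x⁻¹ (begin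
    x⁻¹ ∙ (x ∙ x⁻¹)  ≡⟨ assoc x⁻¹ x x⁻¹ ⟨
    (x⁻¹ ∙ x) ∙ x⁻¹  ≡⟨ ≡.cong (_∙ x⁻¹) (proj₂ (inverseˡ x)) ⟩
    ε ∙ x⁻¹          ≡⟨ identityˡ x⁻¹ ⟩
    x⁻¹              ≡⟨ identityʳ x⁻¹ ⟨
    x⁻¹ ∙ ε          ∎)
    where x⁻¹ = proj₁ (inverseˡ x)

-- E(a,b,c,t) E(x,y,z,s) = E((a,b,c,t) ⋆ (x,y,z,s)).  The law is stated over an
-- arbitrary ring signature so that it serves both for field elements and for the
-- solver's polynomials.
module HeisenbergLaw {a} {A : Set a} (_+_ _*_ : A → A → A) (-_ : A → A) (0# : A) where

  infixl 7 _⋆_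

  _⋆_ : (A × A × A) × A → (A × A × A) × A → (A × A × A) × A
  ((a , b , c) , t) ⋆ ((x , y , z) , s) =
    ( ((((a + x) + (- (b * z))) + (c * y)) + (- ((c * z) * s)))
    , ((b + y) + (c * s))
    , (c + z) )
    , (t + s)

  ε : (A × A × A) × A
  ε = (0# , 0# , 0#) , 0#

  _⁻¹ : (A × A × A) × A → (A × A × A) × A
  ((x , y , z) , s) ⁻¹ = ((- x) , ((z * s) + (- y)) , (- z)) , (- s)

coord : ∀ {a} {A : Set a} → Fin 4 → (A × A × A) × A → A
coord 0F ((a , b , c) , t) = a
coord 1F ((a , b , c) , t) = b
coord 2F ((a , b , c) , t) = c
coord 3F ((a , b , c) , t) = t

quadruple-≡ : ∀ {a} {A : Set a} {a b c t a′ b′ c′ t′ : A} →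
              a ≡ a′ → b ≡ b′ → c ≡ c′ → t ≡ t′ → ((a , b , c) , t) ≡ ((a′ , b′ , c′) , t′)
quadruple-≡ ≡.refl ≡.refl ≡.refl ≡.refl = ≡.refl

module _ (K : FiniteField) where
  open FF K
  open ≡ using (refl; sym; trans; cong; cong₂; subst)
  open ≡.≡-Reasoning

  commutativeRing : CommutativeRing _ _
  commutativeRing = record
    { Carrier = F ; _≈_ = _≡_ ; _+_ = _+_ ; _*_ = _*_ ; -_ = -_ ; 0# = 0# ; 1# = 1#
    ; isCommutativeRing = isCommutativeRing
    }

  open CommutativeRing commutativeRing
    using (+-identityʳ; *-assoc; *-comm; *-identityˡ; *-identityʳ; -‿inverseˡ; -‿inverseʳ; zeroʳ; ring)
  open import Algebra.Properties.Ring ring using (x+x≈x⇒x≈0; +-inverseˡ-unique; -0#≈0#)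
  open IntegerCoefficients commutativeRing using (solve; _:=_; Polynomial; con; _:+_; _:*_; _:-_; :-_)

  F³ F⁴ : Set
  F³ = F × F × F
  F⁴ = F³ × F

  open HeisenbergLaw _+_ _*_ -_ 0# public
  module HeisenbergLawᴾ {n : ℕ} = HeisenbergLaw {A = Polynomial n} _:+_ _:*_ :-_ (con (ℤ.+ 0))
  open HeisenbergLawᴾ using () renaming (_⋆_ to _⋆ᴾ_; ε to εᴾ; _⁻¹ to _⁻¹ᴾ)

  1#≢0# : ¬ 1# ≡ 0#
  1#≢0# = 0≢1 ∘ sym

  *-cancelˡ : ∀ {a x y} → ¬ a ≡ 0# → a * x ≡ a * y → x ≡ y
  *-cancelˡ {a} {x} {y} a≢0 ax≡ay = begin
    x              ≡⟨ *-identityˡ x ⟨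
    1# * x         ≡⟨ cong (_* x) a⁻¹a≡1 ⟨
    (a⁻¹ * a) * x  ≡⟨ *-assoc a⁻¹ a x ⟩
    a⁻¹ * (a * x)  ≡⟨ cong (a⁻¹ *_) ax≡ay ⟩
    a⁻¹ * (a * y)  ≡⟨ *-assoc a⁻¹ a y ⟨
    (a⁻¹ * a) * y  ≡⟨ cong (_* y) a⁻¹a≡1 ⟩
    1# * y         ≡⟨ *-identityˡ y ⟩
    y              ∎
    where
    a⁻¹ = proj₁ (inverse a a≢0)
    a⁻¹a≡1 = trans (*-comm a⁻¹ a) (proj₂ (inverse a a≢0))

  *-≢0 : ∀ {a b} → ¬ a ≡ 0# → ¬ b ≡ 0# → ¬ a * b ≡ 0#
  *-≢0 {a} a≢0 b≢0 ab≡0 = b≢0 (*-cancelˡ a≢0 (trans ab≡0 (sym (zeroʳ a))))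

  inverse-≢0 : ∀ {a b} → a * b ≡ 1# → ¬ b ≡ 0#
  inverse-≢0 {a} ab≡1 b≡0 = 1#≢0# (trans (sym ab≡1) (trans (cong (a *_) b≡0) (zeroʳ a)))

  1#≡μ*1#⇒μ≡1# : ∀ {μ} → 1# ≡ μ * 1# → μ ≡ 1#
  1#≡μ*1#⇒μ≡1# {μ} 1≡μ1 = trans (sym (*-identityʳ μ)) (sym 1≡μ1)

  scaled-by-1 : ∀ {μ x y} → μ ≡ 1# → x ≡ μ * y → x ≡ y
  scaled-by-1 {y = y} refl x≡1y = trans x≡1y (*-identityˡ y)

  Ê : F⁴ → Mat4
  Ê ((a , b , c) , t) = E a b c t

  affine : F³ → Vec4
  affine (a , b , c) 0F = a
  affine (a , b , c) 1F = b
  affine (a , b , c) 2F = c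
  affine (a , b , c) 3F = 1#

  mapF³ : (F → F) → F³ → F³
  mapF³ f (a , b , c) = f a , f b , f c

  mapF⁴ : (F → F) → F⁴ → F⁴
  mapF⁴ f (p , t) = mapF³ f p , f t

  mapF⁴-cong : ∀ {f g} → (∀ s → f s ≡ g s) → ∀ v → mapF⁴ f v ≡ mapF⁴ g v
  mapF⁴-cong f≗g ((a , b , c) , t) = quadruple-≡ (f≗g a) (f≗g b) (f≗g c) (f≗g t)

  module _ (σ : Aut) where

    ⟦⟧-0# : ⟦ σ ⟧ 0# ≡ 0#
    ⟦⟧-0# = x+x≈x⇒x≈0 _ (trans (sym (hom-+ σ 0# 0#)) (cong ⟦ σ ⟧ (+-identityʳ 0#)))

    ⟦⟧-neg : ∀ x → ⟦ σ ⟧ (- x) ≡ - ⟦ σ ⟧ x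
    ⟦⟧-neg x = +-inverseˡ-unique _ _ (begin
      ⟦ σ ⟧ (- x) + ⟦ σ ⟧ x  ≡⟨ hom-+ σ (- x) x ⟨
      ⟦ σ ⟧ (- x + x)        ≡⟨ cong ⟦ σ ⟧ (-‿inverseˡ x) ⟩
      ⟦ σ ⟧ 0#               ≡⟨ ⟦⟧-0# ⟩
      0#                     ∎)

    ⟦⟧-sub : ∀ x y → ⟦ σ ⟧ (x - y) ≡ ⟦ σ ⟧ x - ⟦ σ ⟧ y
    ⟦⟧-sub x y = trans (hom-+ σ x (- y)) (cong (⟦ σ ⟧ x +_) (⟦⟧-neg y))

    ⟦⟧-injective : ∀ {x y} → ⟦ σ ⟧ x ≡ ⟦ σ ⟧ y → x ≡ y
    ⟦⟧-injective = proj₁ (bij σ)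

    ⟦⟧-≢0 : ∀ {x} → ¬ x ≡ 0# → ¬ ⟦ σ ⟧ x ≡ 0#
    ⟦⟧-≢0 x≢0 σx≡0 = x≢0 (⟦⟧-injective (trans σx≡0 (sym ⟦⟧-0#)))

    mapF³-surjective : ∀ p → Σ F³ λ p′ → mapF³ ⟦ σ ⟧ p′ ≡ p
    mapF³-surjective (a , b , c) =
      (pre a , pre b , pre c) , cong₂ _,_ (section a) (cong₂ _,_ (section b) (section c))
      where
      pre : F → F
      pre y = proj₁ (proj₂ (bij σ) y)
      section : ∀ y → ⟦ σ ⟧ (pre y) ≡ y
      section y = proj₂ (proj₂ (bij σ) y) refl

    ⟦⟧-⋆ : ∀ v w → mapF⁴ ⟦ σ ⟧ (v ⋆ w) ≡ mapF⁴ ⟦ σ ⟧ v ⋆ mapF⁴ ⟦ σ ⟧ w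
    ⟦⟧-⋆ ((a , b , c) , t) ((x , y , z) , s) = quadruple-≡
      (trans (⟦⟧-sub _ _) (cong₂ _-_
        (trans (hom-+ σ _ _) (cong₂ _+_
          (trans (⟦⟧-sub _ _) (cong₂ _-_ (hom-+ σ a x) (hom-* σ b z)))
          (hom-* σ c y)))
        (trans (hom-* σ _ s) (cong (_* ⟦ σ ⟧ s) (hom-* σ c z)))))
      (trans (hom-+ σ _ _) (cong₂ _+_ (hom-+ σ b y) (hom-* σ c s)))
      (hom-+ σ c z)
      (hom-+ σ t s)

    ⟦⟧-E : ∀ v i j → ⟦ σ ⟧ (Ê v i j) ≡ Ê (mapF⁴ ⟦ σ ⟧ v) i j
    ⟦⟧-E v                 0F 0F            = hom-1 σ
    ⟦⟧-E v                 0F (suc _)       = ⟦⟧-0#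
    ⟦⟧-E v                 1F 0F            = ⟦⟧-neg _
    ⟦⟧-E v                 1F 1F            = hom-1 σ
    ⟦⟧-E v                 1F (suc (suc _)) = ⟦⟧-0#
    ⟦⟧-E ((a , b , c) , t) 2F 0F            = trans (⟦⟧-sub b (c * t)) (cong₂ _-_ refl (hom-* σ c t))
    ⟦⟧-E v                 2F 1F            = refl
    ⟦⟧-E v                 2F 2F            = hom-1 σ
    ⟦⟧-E v                 2F 3F            = ⟦⟧-0#
    ⟦⟧-E v                 3F 0F            = refl
    ⟦⟧-E v                 3F 1F            = refl
    ⟦⟧-E v                 3F 2F            = refl
    ⟦⟧-E v                 3F 3F            = hom-1 σ

    ⟦⟧-affine : ∀ p i → ⟦ σ ⟧ (affine p i) ≡ affine (mapF³ ⟦ σ ⟧ p) i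
    ⟦⟧-affine p 0F = refl
    ⟦⟧-affine p 1F = refl
    ⟦⟧-affine p 2F = refl
    ⟦⟧-affine p 3F = hom-1 σ

  Eᴾ : ∀ {n} → (Polynomial n × Polynomial n × Polynomial n) × Polynomial n → Fin 4 → Fin 4 → Polynomial n
  Eᴾ v                 0F 0F            = con (ℤ.+ 1)
  Eᴾ v                 0F (suc _)       = con (ℤ.+ 0)
  Eᴾ ((a , b , c) , t) 1F 0F            = :- c
  Eᴾ v                 1F 1F            = con (ℤ.+ 1)
  Eᴾ v                 1F (suc (suc _)) = con (ℤ.+ 0)
  Eᴾ ((a , b , c) , t) 2F 0F            = b :- c :* t
  Eᴾ ((a , b , c) , t) 2F 1F            = t
  Eᴾ v                 2F 2F            = con (ℤ.+ 1)
  Eᴾ v                 2F 3F            = con (ℤ.+ 0)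
  Eᴾ ((a , b , c) , t) 3F 0F            = a
  Eᴾ ((a , b , c) , t) 3F 1F            = b
  Eᴾ ((a , b , c) , t) 3F 2F            = c
  Eᴾ v                 3F 3F            = con (ℤ.+ 1)

  E-mul : ∀ v w i j → (Ê v ·ₘ Ê w) i j ≡ Ê (v ⋆ w) i j
  E-mul ((a , b , c) , t) ((x , y , z) , s) i j = entry i j a b c t x y z s
    where
    law : Fin 4 → Fin 4 → N-ary 8 (Polynomial 8) (Polynomial 8 × Polynomial 8)
    law i j a b c t x y z s =
      let v = (a , b , c) , t ; w = (x , y , z) , s in
      Eᴾ v i 0F :* Eᴾ w 0F j
        :+ (Eᴾ v i 1F :* Eᴾ w 1F j :+ (Eᴾ v i 2F :* Eᴾ w 2F j :+ Eᴾ v i 3F :* Eᴾ w 3F j))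
      := Eᴾ (v ⋆ᴾ w) i j
    entry : ∀ i j a b c t x y z s →
            (E a b c t ·ₘ E x y z s) i j ≡ Ê (((a , b , c) , t) ⋆ ((x , y , z) , s)) i j
    entry 0F 0F = solve 8 (law 0F 0F) refl
    entry 0F 1F = solve 8 (law 0F 1F) refl
    entry 0F 2F = solve 8 (law 0F 2F) refl
    entry 0F 3F = solve 8 (law 0F 3F) refl
    entry 1F 0F = solve 8 (law 1F 0F) refl
    entry 1F 1F = solve 8 (law 1F 1F) refl
    entry 1F 2F = solve 8 (law 1F 2F) refl
    entry 1F 3F = solve 8 (law 1F 3F) refl
    entry 2F 0F = solve 8 (law 2F 0F) refl
    entry 2F 1F = solve 8 (law 2F 1F) refl
    entry 2F 2F = solve 8 (law 2F 2F) refl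
    entry 2F 3F = solve 8 (law 2F 3F) refl
    entry 3F 0F = solve 8 (law 3F 0F) refl
    entry 3F 1F = solve 8 (law 3F 1F) refl
    entry 3F 2F = solve 8 (law 3F 2F) refl
    entry 3F 3F = solve 8 (law 3F 3F) refl

  ⋆-assoc : Associative _≡_ _⋆_
  ⋆-assoc ((a , b , c) , t) ((x , y , z) , s) ((x′ , y′ , z′) , s′) = quadruple-≡
    (solve 12 (law 0F) refl a b c t x y z s x′ y′ z′ s′)
    (solve 12 (law 1F) refl a b c t x y z s x′ y′ z′ s′)
    (solve 12 (law 2F) refl a b c t x y z s x′ y′ z′ s′)
    (solve 12 (law 3F) refl a b c t x y z s x′ y′ z′ s′)
    where
    law : Fin 4 → N-ary 12 (Polynomial 12) (Polynomial 12 × Polynomial 12)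
    law i a b c t x y z s x′ y′ z′ s′ =
      let u = (a , b , c) , t ; v = (x , y , z) , s ; w = (x′ , y′ , z′) , s′ in
      coord i ((u ⋆ᴾ v) ⋆ᴾ w) := coord i (u ⋆ᴾ (v ⋆ᴾ w))

  ⋆-identityˡ : LeftIdentity _≡_ ε _⋆_
  ⋆-identityˡ ((x , y , z) , s) = quadruple-≡
    (solve 4 (law 0F) refl x y z s) (solve 4 (law 1F) refl x y z s)
    (solve 4 (law 2F) refl x y z s) (solve 4 (law 3F) refl x y z s)
    where
    law : Fin 4 → N-ary 4 (Polynomial 4) (Polynomial 4 × Polynomial 4)
    law i x y z s = coord i (εᴾ ⋆ᴾ ((x , y , z) , s)) := coord i ((x , y , z) , s)

  ⋆-identityʳ : RightIdentity _≡_ ε _⋆_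
  ⋆-identityʳ ((a , b , c) , t) = quadruple-≡
    (solve 4 (law 0F) refl a b c t) (solve 4 (law 1F) refl a b c t)
    (solve 4 (law 2F) refl a b c t) (solve 4 (law 3F) refl a b c t)
    where
    law : Fin 4 → N-ary 4 (Polynomial 4) (Polynomial 4 × Polynomial 4)
    law i a b c t = coord i (((a , b , c) , t) ⋆ᴾ εᴾ) := coord i ((a , b , c) , t)

  ⋆-inverseˡ : ∀ w → w ⁻¹ ⋆ w ≡ ε
  ⋆-inverseˡ ((x , y , z) , s) = quadruple-≡
    (solve 4 (law 0F) refl x y z s) (solve 4 (law 1F) refl x y z s)
    (solve 4 (law 2F) refl x y z s) (solve 4 (law 3F) refl x y z s)
    where
    law : Fin 4 → N-ary 4 (Polynomial 4) (Polynomial 4 × Polynomial 4)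
    law i x y z s = coord i ((((x , y , z) , s) ⁻¹ᴾ) ⋆ᴾ ((x , y , z) , s)) := coord i εᴾ

  idMat≡Ê-ε : ∀ i j → idMat i j ≡ Ê ε i j
  idMat≡Ê-ε 0F 0F            = refl
  idMat≡Ê-ε 0F (suc _)       = refl
  idMat≡Ê-ε 1F 0F            = sym -0#≈0#
  idMat≡Ê-ε 1F 1F            = refl
  idMat≡Ê-ε 1F (suc (suc _)) = refl
  idMat≡Ê-ε 2F 0F            = sym (trans (cong₂ _-_ refl (zeroʳ 0#)) (-‿inverseʳ 0#))
  idMat≡Ê-ε 2F 1F            = refl
  idMat≡Ê-ε 2F 2F            = refl
  idMat≡Ê-ε 2F 3F            = refl
  idMat≡Ê-ε 3F 0F            = refl
  idMat≡Ê-ε 3F 1F            = refl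
  idMat≡Ê-ε 3F 2F            = refl
  idMat≡Ê-ε 3F 3F            = refl

  Ê-last-row : ∀ v j → Ê v 3F j ≡ affine (proj₁ v) j
  Ê-last-row v 0F = refl
  Ê-last-row v 1F = refl
  Ê-last-row v 2F = refl
  Ê-last-row v 3F = refl

  Ê-scaled-injective : ∀ {v w μ} → (∀ i j → Ê v i j ≡ μ * Ê w i j) → v ≡ w
  Ê-scaled-injective {v} {w} {μ} v≡μw = quadruple-≡ (entry 3F 0F) (entry 3F 1F) (entry 3F 2F) (entry 2F 1F)
    where
    entry : ∀ i j → Ê v i j ≡ Ê w i j
    entry i j = scaled-by-1 (1#≡μ*1#⇒μ≡1# (v≡μw 0F 0F)) (v≡μw i j)

  sum4-cong : ∀ {f g : Fin 4 → F} → (∀ k → f k ≡ g k) → sum4 f ≡ sum4 g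
  sum4-cong f≗g = cong₂ _+_ (f≗g 0F) (cong₂ _+_ (f≗g 1F) (cong₂ _+_ (f≗g 2F) (f≗g 3F)))

  ·ᵥ-cong : ∀ {v w} A j → (∀ i → v i ≡ w i) → (v ·ᵥ A) j ≡ (w ·ᵥ A) j
  ·ᵥ-cong A j v≗w = sum4-cong λ i → cong (_* A i j) (v≗w i)

  ·ᵥ-*ˡ : ∀ μ v A j → ((λ i → μ * v i) ·ᵥ A) j ≡ μ * (v ·ᵥ A) j
  ·ᵥ-*ˡ μ v A j = solve 9
    (λ μ v₀ v₁ v₂ v₃ a₀ a₁ a₂ a₃ →
      μ :* v₀ :* a₀ :+ (μ :* v₁ :* a₁ :+ (μ :* v₂ :* a₂ :+ μ :* v₃ :* a₃))
      := μ :* (v₀ :* a₀ :+ (v₁ :* a₁ :+ (v₂ :* a₂ :+ v₃ :* a₃))))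
    refl μ (v 0F) (v 1F) (v 2F) (v 3F) (A 0F j) (A 1F j) (A 2F j) (A 3F j)

  ≗⇒∼ : ∀ {v w} → (∀ i → v i ≡ w i) → v ∼ w
  ≗⇒∼ v≗w = 1# , 1#≢0# , λ i → sym (trans (*-identityˡ _) (v≗w i))

  ∼-sym : ∀ {v w} → v ∼ w → w ∼ v
  ∼-sym {v} {w} (μ , μ≢0 , w≡μv) = μ⁻¹ , inverse-≢0 μμ⁻¹≡1 , λ i → begin
    v i              ≡⟨ *-identityˡ (v i) ⟨
    1# * v i         ≡⟨ cong (_* v i) (trans (sym μμ⁻¹≡1) (*-comm μ μ⁻¹)) ⟩
    (μ⁻¹ * μ) * v i  ≡⟨ *-assoc μ⁻¹ μ (v i) ⟩
    μ⁻¹ * (μ * v i)  ≡⟨ cong (μ⁻¹ *_) (w≡μv i) ⟨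
    μ⁻¹ * w i        ∎
    where
    μ⁻¹ = proj₁ (inverse μ μ≢0)
    μμ⁻¹≡1 = proj₂ (inverse μ μ≢0)

  ∼-trans : ∀ {u v w} → u ∼ v → v ∼ w → u ∼ w
  ∼-trans (μ , μ≢0 , v≡μu) (ν , ν≢0 , w≡νv) = ν * μ , *-≢0 ν≢0 μ≢0 , λ i →
    trans (w≡νv i) (trans (cong (ν *_) (v≡μu i)) (sym (*-assoc ν μ _)))

  apply-∼ : ∀ A σ {v w} → v ∼ w → apply ⟨ A , ⟦ σ ⟧ ⟩ v ∼ apply ⟨ A , ⟦ σ ⟧ ⟩ w
  apply-∼ A σ {v} {w} (μ , μ≢0 , w≡μv) = ⟦ σ ⟧ μ , ⟦⟧-≢0 σ μ≢0 , λ j → begin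
    ((λ i → ⟦ σ ⟧ (w i)) ·ᵥ A) j             ≡⟨ ·ᵥ-cong A j (λ i → trans (cong ⟦ σ ⟧ (w≡μv i)) (hom-* σ μ (v i))) ⟩
    ((λ i → ⟦ σ ⟧ μ * ⟦ σ ⟧ (v i)) ·ᵥ A) j  ≡⟨ ·ᵥ-*ˡ (⟦ σ ⟧ μ) (⟦ σ ⟧ ∘ v) A j ⟩
    ⟦ σ ⟧ μ * ((λ i → ⟦ σ ⟧ (v i)) ·ᵥ A) j  ∎

  affine-injective : ∀ {p q} → affine p ∼ affine q → p ≡ q
  affine-injective {a , b , c} {a′ , b′ , c′} (μ , _ , q≡μp) =
    sym (cong₂ _,_ (entry 0F) (cong₂ _,_ (entry 1F) (entry 2F)))
    where
    entry : ∀ i → affine (a′ , b′ , c′) i ≡ affine (a , b , c) i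
    entry i = scaled-by-1 (1#≡μ*1#⇒μ≡1# (q≡μp 3F)) (q≡μp i)

  affine-∼ : ∀ v → ¬ v 3F ≡ 0# → Σ F³ λ p → affine p ∼ v
  affine-∼ v v₃≢0 = (v 0F * v₃⁻¹ , v 1F * v₃⁻¹ , v 2F * v₃⁻¹) , v 3F , v₃≢0 , λ where
      0F → rescale (v 0F)
      1F → rescale (v 1F)
      2F → rescale (v 2F)
      3F → sym (*-identityʳ (v 3F))
    where
    v₃⁻¹ = proj₁ (inverse (v 3F) v₃≢0)
    rescale : ∀ x → x ≡ v 3F * (x * v₃⁻¹)
    rescale x = begin
      x                    ≡⟨ *-identityʳ x ⟨
      x * 1#               ≡⟨ cong (x *_) (proj₂ (inverse (v 3F) v₃≢0)) ⟨
      x * (v 3F * v₃⁻¹)    ≡⟨ solve 3 (λ x v₃ w → x :* (v₃ :* w) := v₃ :* (x :* w)) refl x (v 3F) v₃⁻¹ ⟩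
      v 3F * (x * v₃⁻¹)    ∎

  form-P : ∀ v → form Pvec v ≡ v 3F
  form-P v = solve 4
    (λ v₀ v₁ v₂ v₃ →
      con (ℤ.+ 1) :* v₃ :- con (ℤ.+ 0) :* v₀ :+ (con (ℤ.+ 0) :* v₂ :- con (ℤ.+ 0) :* v₁) := v₃)
    refl (v 0F) (v 1F) (v 2F) (v 3F)

  QPoint-vec₃≢0 : ∀ X → ¬ vec X 3F ≡ 0#
  QPoint-vec₃≢0 X v₃≡0 = notPerp X (trans (form-P (vec X)) v₃≡0)

  ≈-refl : ∀ {g} → g ≈ g
  ≈-refl = (λ _ → refl) , 1# , 1#≢0# , λ _ _ → sym (*-identityˡ _)

  ≈-trans : ∀ {g h k} → g ≈ h → h ≈ k → g ≈ k
  ≈-trans (σg≗σh , μ , μ≢0 , h≡μg) (σh≗σk , ν , ν≢0 , k≡νh) =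
    (λ t → trans (σg≗σh t) (σh≗σk t)) , ν * μ , *-≢0 ν≢0 μ≢0 , λ i j →
      trans (k≡νh i j) (trans (cong (ν *_) (h≡μg i j)) (sym (*-assoc ν μ _)))

  module _ (T : F → F → F → F) (θ : F → F → F → Aut) where

    θᵗ : F³ → Aut
    θᵗ (a , b , c) = θ a b c

    Tᵗ : F³ → F
    Tᵗ (a , b , c) = T a b c

    𝔤ᵗ : F³ → SemiLin
    𝔤ᵗ (a , b , c) = 𝔤 T θ a b c

    lift : F³ → F⁴
    lift p = p , Tᵗ p

    twist : F³ → F⁴ → F⁴
    twist q = mapF⁴ ⟦ θᵗ q ⟧

    -- (a,b,c) ⊙ (x,y,z) is the triple (u,v,w) of the statement, and mat (𝔤ᵗ p) is Ê (lift p).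
    infixl 7 _⊙_
    _⊙_ : F³ → F³ → F³
    p ⊙ q = proj₁ (twist q (lift p) ⋆ lift q)

    e : F³
    e = 0# , 0# , 0#

    𝔤-∘-mat : ∀ p q i j → mat (𝔤ᵗ p ∘ₛ 𝔤ᵗ q) i j ≡ Ê (twist q (lift p) ⋆ lift q) i j
    𝔤-∘-mat p@(_ , _ , _) q@(_ , _ , _) i j = trans
      (sum4-cong λ k → cong (_* Ê (lift q) k j) (⟦⟧-E (θᵗ q) (lift p) i k))
      (E-mul (twist q (lift p)) (lift q) i j)

    composite≈𝔤⇒lift : ∀ p q r → (𝔤ᵗ p ∘ₛ 𝔤ᵗ q) ≈ 𝔤ᵗ r → lift r ≡ twist q (lift p) ⋆ lift q
    composite≈𝔤⇒lift p q (_ , _ , _) (_ , μ , _ , r≡μpq) =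
      Ê-scaled-injective λ i j → trans (r≡μpq i j) (cong (μ *_) (𝔤-∘-mat p q i j))

    apply-𝔤-affine : ∀ p q j → apply (𝔤ᵗ q) (affine p) j ≡ affine (p ⊙ q) j
    apply-𝔤-affine p q@(_ , _ , _) j = begin
      apply (𝔤ᵗ q) (affine p) j               ≡⟨ ·ᵥ-cong (Ê (lift q)) j (λ i →
                                                   trans (⟦⟧-affine (θᵗ q) p i) (sym (Ê-last-row (twist q (lift p)) i))) ⟩
      (Ê (twist q (lift p)) ·ₘ Ê (lift q)) 3F j  ≡⟨ E-mul (twist q (lift p)) (lift q) 3F j ⟩
      Ê (twist q (lift p) ⋆ lift q) 3F j         ≡⟨ Ê-last-row (twist q (lift p) ⋆ lift q) j ⟩
      affine (p ⊙ q) j                           ∎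

    𝔤-orbit : ∀ {v} p q → affine p ∼ v → apply (𝔤ᵗ q) v ∼ affine (p ⊙ q)
    𝔤-orbit p q@(_ , _ , _) p∼v =
      ∼-trans (apply-∼ (Ê (lift q)) (θᵗ q) (∼-sym p∼v)) (≗⇒∼ (apply-𝔤-affine p q))

    -- The first three coordinates of v ⋆ w do not depend on the last coordinate of v.
    ⊙-identityˡ : LeftIdentity _≡_ e _⊙_
    ⊙-identityˡ q = begin
      e ⊙ q               ≡⟨ cong (λ p → proj₁ ((p , ⟦ θᵗ q ⟧ (Tᵗ e)) ⋆ lift q)) σe≡e ⟩
      proj₁ (ε ⋆ lift q)  ≡⟨ cong proj₁ (⋆-identityˡ (lift q)) ⟩
      q                   ∎
      where
      σe≡e : mapF³ ⟦ θᵗ q ⟧ e ≡ e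
      σe≡e = cong₂ _,_ (⟦⟧-0# (θᵗ q)) (cong₂ _,_ (⟦⟧-0# (θᵗ q)) (⟦⟧-0# (θᵗ q)))

    CompositionLaw⇒FunctionalEqs : CompositionLaw T θ → FunctionalEqs T θ
    CompositionLaw⇒FunctionalEqs law a b c x y z =
      proj₁ (law a b c x y z) ,
      sym (cong proj₂ (composite≈𝔤⇒lift (a , b , c) (x , y , z) _ (law a b c x y z)))

    closure⇒CompositionLaw : GIsGroup T θ → CompositionLaw T θ
    closure⇒CompositionLaw (_ , closed , _) a b c x y z with closed a b c x y z
    ... | u , v , w , composite≈ = subst (λ r → (𝔤ᵗ (a , b , c) ∘ₛ 𝔤ᵗ (x , y , z)) ≈ 𝔤ᵗ r)
            (cong proj₁ (composite≈𝔤⇒lift (a , b , c) (x , y , z) (u , v , w) composite≈)) composite≈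

    module FunctionalEquations (fe : FunctionalEqs T θ) where

      θ-⊙ : ∀ p q s → ⟦ θᵗ q ⟧ (⟦ θᵗ p ⟧ s) ≡ ⟦ θᵗ (p ⊙ q) ⟧ s
      θ-⊙ (a , b , c) (x , y , z) = proj₁ (fe a b c x y z)

      lift-⊙ : ∀ p q → lift (p ⊙ q) ≡ twist q (lift p) ⋆ lift q
      lift-⊙ p@(a , b , c) q@(x , y , z) = cong (p ⊙ q ,_) (sym (proj₂ (fe a b c x y z)))

      𝔤-⊙ : ∀ p q → (𝔤ᵗ p ∘ₛ 𝔤ᵗ q) ≈ 𝔤ᵗ (p ⊙ q)
      𝔤-⊙ p@(_ , _ , _) q@(_ , _ , _) = θ-⊙ p q , 1# , 1#≢0# , λ i j → begin
        Ê (lift (p ⊙ q)) i j                ≡⟨ cong (λ v → Ê v i j) (lift-⊙ p q) ⟩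
        Ê (twist q (lift p) ⋆ lift q) i j   ≡⟨ 𝔤-∘-mat p q i j ⟨
        mat (𝔤ᵗ p ∘ₛ 𝔤ᵗ q) i j              ≡⟨ *-identityˡ _ ⟨
        1# * mat (𝔤ᵗ p ∘ₛ 𝔤ᵗ q) i j         ∎

      composition : CompositionLaw T θ
      composition a b c x y z = 𝔤-⊙ (a , b , c) (x , y , z)

      θ-e : ∀ s → ⟦ θᵗ e ⟧ s ≡ s
      θ-e s = ⟦⟧-injective (θᵗ e) (trans (θ-⊙ e e s) (cong (λ r → ⟦ θᵗ r ⟧ s) (⊙-identityˡ e)))

      T-e : Tᵗ e ≡ 0#
      T-e = x+x≈x⇒x≈0 (Tᵗ e) (begin
        Tᵗ e + Tᵗ e              ≡⟨ cong (_+ Tᵗ e) (θ-e (Tᵗ e)) ⟨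
        ⟦ θᵗ e ⟧ (Tᵗ e) + Tᵗ e   ≡⟨ cong proj₂ (lift-⊙ e e) ⟨
        Tᵗ (e ⊙ e)               ≡⟨ cong Tᵗ (⊙-identityˡ e) ⟩
        Tᵗ e                     ∎)

      lift-e : lift e ≡ ε
      lift-e = cong (e ,_) T-e

      ⊙-identityʳ : RightIdentity _≡_ e _⊙_
      ⊙-identityʳ p = cong proj₁ (begin
        twist e (lift p) ⋆ lift e  ≡⟨ cong₂ _⋆_ (mapF⁴-cong θ-e (lift p)) lift-e ⟩
        lift p ⋆ ε                 ≡⟨ ⋆-identityʳ (lift p) ⟩
        lift p                     ∎)

      ⊙-assoc : Associative _≡_ _⊙_
      ⊙-assoc p q r = cong proj₁ (begin
        lift ((p ⊙ q) ⊙ r)                                         ≡⟨ lift-⊙ (p ⊙ q) r ⟩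
        twist r (lift (p ⊙ q)) ⋆ lift r                            ≡⟨ cong (λ v → twist r v ⋆ lift r) (lift-⊙ p q) ⟩
        twist r (twist q (lift p) ⋆ lift q) ⋆ lift r               ≡⟨ cong (_⋆ lift r) (⟦⟧-⋆ (θᵗ r) _ _) ⟩
        (twist r (twist q (lift p)) ⋆ twist r (lift q)) ⋆ lift r   ≡⟨ ⋆-assoc _ _ _ ⟩
        twist r (twist q (lift p)) ⋆ (twist r (lift q) ⋆ lift r)   ≡⟨ cong₂ _⋆_ (mapF⁴-cong (θ-⊙ q r) (lift p))
                                                                                (sym (lift-⊙ q r)) ⟩
        twist (q ⊙ r) (lift p) ⋆ lift (q ⊙ r)                      ≡⟨ lift-⊙ p (q ⊙ r) ⟨
        lift (p ⊙ (q ⊙ r))                                         ∎)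

      -- p is chosen so that twist q (lift p) and (lift q)⁻¹ agree in the first three
      -- coordinates, which are all that matters for the left factor of ⋆.
      ⊙-inverseˡ : ∀ q → Σ F³ λ p → p ⊙ q ≡ e
      ⊙-inverseˡ q with mapF³-surjective (θᵗ q) (proj₁ (lift q ⁻¹))
      ... | p , σp≡ = p , (begin
        p ⊙ q                       ≡⟨ cong (λ p′ → proj₁ ((p′ , ⟦ θᵗ q ⟧ (Tᵗ p)) ⋆ lift q)) σp≡ ⟩
        proj₁ (lift q ⁻¹ ⋆ lift q)  ≡⟨ cong proj₁ (⋆-inverseˡ (lift q)) ⟩
        e                           ∎)

      open LeftInverses _⊙_ e ⊙-assoc ⊙-identityˡ ⊙-identityʳ ⊙-inverseˡ

      𝔤-e≈id : 𝔤ᵗ e ≈ idSL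
      𝔤-e≈id = θ-e , 1# , 1#≢0# , λ i j → begin
        idMat i j            ≡⟨ idMat≡Ê-ε i j ⟩
        Ê ε i j              ≡⟨ cong (λ v → Ê v i j) lift-e ⟨
        Ê (lift e) i j       ≡⟨ *-identityˡ _ ⟨
        1# * Ê (lift e) i j  ∎

      group : GIsGroup T θ
      group = (0# , 0# , 0# , 𝔤-e≈id) , closed , inverses
        where
        closed : ∀ a b c x y z → Σ F λ u → Σ F λ v → Σ F λ w → (𝔤 T θ a b c ∘ₛ 𝔤 T θ x y z) ≈ 𝔤 T θ u v w
        closed a b c x y z =
          uᶜ T θ a b c x y z , vᶜ T θ a b c x y z , wᶜ T θ a b c x y z , composition a b c x y z

        inverses : ∀ a b c → Σ F λ x → Σ F λ y → Σ F λ z → (𝔤 T θ a b c ∘ₛ 𝔤 T θ x y z) ≈ idSL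
        inverses a b c = proj₁ q , proj₁ (proj₂ q) , proj₂ (proj₂ q) ,
          ≈-trans (𝔤-⊙ (a , b , c) q) (subst (λ r → 𝔤ᵗ r ≈ idSL) (sym p⊙q≡e) 𝔤-e≈id)
          where
          q = proj₁ (inverseʳ (a , b , c))
          p⊙q≡e = proj₂ (inverseʳ (a , b , c))

      regular : GActsRegularly T θ
      regular X Y = existence , uniqueness
        where
        pX = proj₁ (affine-∼ (vec X) (QPoint-vec₃≢0 X))
        pX∼X = proj₂ (affine-∼ (vec X) (QPoint-vec₃≢0 X))
        pY = proj₁ (affine-∼ (vec Y) (QPoint-vec₃≢0 Y))
        pY∼Y = proj₂ (affine-∼ (vec Y) (QPoint-vec₃≢0 Y))

        existence : Σ F λ a → Σ F λ b → Σ F λ c → apply (𝔤 T θ a b c) (vec X) ∼ vec Y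
        existence = proj₁ q , proj₁ (proj₂ q) , proj₂ (proj₂ q) ,
          ∼-trans (𝔤-orbit pX q pX∼X) (subst (λ r → affine r ∼ vec Y) (sym pX⊙q≡pY) pY∼Y)
          where
          h = proj₁ (inverseʳ pX)
          q = h ⊙ pY
          pX⊙q≡pY : pX ⊙ q ≡ pY
          pX⊙q≡pY = begin
            pX ⊙ (h ⊙ pY)  ≡⟨ ⊙-assoc pX h pY ⟨
            (pX ⊙ h) ⊙ pY  ≡⟨ cong (_⊙ pY) (proj₂ (inverseʳ pX)) ⟩
            e ⊙ pY         ≡⟨ ⊙-identityˡ pY ⟩
            pY             ∎

        uniqueness : ∀ a b c a′ b′ c′ → apply (𝔤 T θ a b c) (vec X) ∼ vec Y
                   → apply (𝔤 T θ a′ b′ c′) (vec X) ∼ vec Y → 𝔤 T θ a b c ≈ 𝔤 T θ a′ b′ c′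
        uniqueness a b c a′ b′ c′ q·X∼Y q′·X∼Y = subst (λ r → 𝔤ᵗ q ≈ 𝔤ᵗ r) q≡q′ ≈-refl
          where
          q q′ : F³
          q = a , b , c
          q′ = a′ , b′ , c′
          q≡q′ : q ≡ q′
          q≡q′ = cancelˡ pX (affine-injective
            (∼-trans (∼-sym (𝔤-orbit pX q pX∼X))
              (∼-trans q·X∼Y (∼-trans (∼-sym q′·X∼Y) (𝔤-orbit pX q′ pX∼X)))))

theorem2p1 : (K : FiniteField) → let open FF K in
    (T : F → F → F → F) (θ : F → F → F → Aut) →
      ((GIsGroup T θ × GActsRegularly T θ) ⇔ CompositionLaw T θ)
    × (CompositionLaw T θ ⇔ FunctionalEqs T θ)
theorem2p1 K T θ =
    mk⇔ (closure⇒CompositionLaw K T θ ∘ proj₁)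
        (λ law → let open FunctionalEquations K T θ (CompositionLaw⇒FunctionalEqs K T θ law)
                 in group , regular)
  , mk⇔ (CompositionLaw⇒FunctionalEqs K T θ) (FunctionalEquations.composition K T θ)
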